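{- Let $M\mapsto M^*$ be the translation from the untyped delimited control calculus to the untyped monadic reflection calculus that is homomorphic on all core constructs and satisfies $(\mathcal{S}_0k.M)^*=\mathtt{reflect}(\lambda k.M^*)$ and $\langle M\mid x.N\rangle^*=(\mathtt{reify}_{\mathrm{Cont}}\,M^*)\,\{\lambda x.N^*\}$, where $\mathrm{Cont}=\mathtt{where}\{\mathtt{return}\,x=\lambda c.\,c!\,x;\ m\gg\!=f=\lambda c.\,m!\,\{\lambda y.\,f!\,y\,c\}\}$. Then for all computations $M,N$ of the delimited control calculus, $M\to N$ implies $M^*\rightsquigarrow^{+}N^*$.
   Context: Core syntax (shared). Values $V ::= x \mid () \mid (V_1,V_2) \mid \ell\,V \mid \{M\}$; computations $M,N ::= \mathtt{let}\,(x,y)=V\,\mathtt{in}\,M \mid \mathtt{case}\,V\,\mathtt{of}\,\{\ell_i x_i\mapsto M_i\}_i \mid V! \mid \mathtt{return}\,V \mid \mathtt{let}\,x\Leftarrow M\,\mathtt{in}\,N \mid \lambda x.M \mid M\,V \mid \langle M_1,M_2\rangle \mid \mathrm{prj}_i M$. Core $\beta$-rules: $\mathtt{let}\,(x,y)=(V_1,V_2)\,\mathtt{in}\,M \to_\beta M[V_1/x,V_2/y]$; $\mathtt{case}\,\ell_j V\,\mathtt{of}\,\{\dots\ell_j x_j\mapsto M_j\dots\}\to_\beta M_j[V/x_j]$; $\{M\}!\to_\beta M$; $\mathtt{let}\,x\Leftarrow\mathtt{return}\,V\,\mathtt{in}\,N\to_\beta N[V/x]$; $(\lambda x.M)V\to_\beta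 M[V/x]$; $\mathrm{prj}_i\langle M_1,M_2\rangle\to_\beta M_i$. Basic frames $B ::= \mathtt{let}\,x\Leftarrow[\,]\,\mathtt{in}\,N\mid[\,]\,V\mid\mathrm{prj}_i[\,]$; hoisting contexts $\mathcal{H}::=[\,]\mid\mathcal{H}[B]$. In each calculus $M\to N$ iff $M=K[M']$, $N=K[N']$ with $M'\to_\beta N'$ and $K$ an evaluation context of that calculus. Delimited control calculus: adds computations $\mathcal{S}_0k.M$ and $\langle M\mid x.N\rangle$; evaluation contexts $K::=[\,]\mid K[B]\mid K[\langle[\,]\mid x.N\rangle]$; extra rules $\langle\mathtt{return}\,V\mid x.N\rangle\to_\beta N[V/x]$ and $\langle\mathcal{H}[\mathcal{S}_0k.M]\mid x.N\rangle\to_\beta M[\{\lambda y.\langle\mathcal{H}[\mathtt{return}\,y]\mid x.N\rangle\}/k]$. Monadic reflection calculus: monad terms $T=\mathtt{where}\{\mathtt{return}\,x=N_u;\ y\gg\!=f=N_b\}$; adds computations $\mathtt{reflect}\,N$ and $\mathtt{reify}_T\,M$; evaluation contexts $K::=[\,]\mid K[B]\mid K[\mathtt{reify}_T[\,]]$; extra rules $\mathtt{reify}_T(\mathtt{return}\,V)\to_\beta N_u[V/x]$ and $\mathtt{reify}_T\,\mathcal{H}[\mathtt{reflect}\,N]\to_\beta N_b[\{N\}/y,\{\lambda z.\mathtt{reify}_T\,\mathcal{H}[\mathtt{return}\,z]\}/f]$. $\rightsquigarrow$ is the smallest relation on terms of the target calculus containing $\to_\beta$ and closed under all term-forming constructs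 (so reduction may occur anywhere, including under binders); $\rightsquigarrow^{+}$ is its transitive closure. The translation is hygienic (bound variables it introduces are fresh). -}

module Defs where

open import Data.Nat using (ℕ; zero; suc; _≡ᵇ_)
open import Data.Fin using (Fin; zero; suc)
open import Data.Maybe using (Maybe; just; nothing)
open import Data.Bool using (if_then_else_)
open import Relation.Binary.PropositionalEquality using (_≡_)
open import Relation.Binary.Construct.Closure.Transitive using (TransClosure)

-- Well-scoped de Bruijn syntax shared by both calculi.
-- A term of scope n has free variables among Fin n; binders extend the
-- scope, so every translation / substitution is automatically hygienic.

data Lang : Set where
  del : Lang
  mon : Lang

variable
  L : Lang
  n m : ℕ

Label : Set
Label = ℕ

mutual
  -- Values  V ::= x | () | (V₁,V₂) | ℓ V | {M}
  data Val (L : Lang) (n : ℕ) : Set where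
    var   : Fin n → Val L n
    unit  : Val L n
    pair  : Val L n → Val L n → Val L n
    inj   : Label → Val L n → Val L n
    thunk : Comp L n → Val L n

  -- Case branches {ℓᵢ xᵢ ↦ Mᵢ}ᵢ  (each body binds xᵢ = var zero)
  data Branches (L : Lang) (n : ℕ) : Set where
    []  : Branches L n
    _∷_ : Label × Comp L (suc n) → Branches L n → Branches L n

  -- Monad terms  where{return x = N_u; y >>= f = N_b}
  -- N_u binds x (= var 0); N_b binds y (= var 1) and then f (= var 0).
  data MonadT (L : Lang) (n : ℕ) : Set where
    monad : Comp L (suc n) → Comp L (suc (suc n)) → MonadT L n

  data Comp : Lang → ℕ → Set where
    -- let (x,y) = V in M     (x = var 1, y = var 0 in M)
    letp    : Val L n → Comp L (suc (suc n)) → Comp L n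
    case    : Val L n → Branches L n → Comp L n
    force   : Val L n → Comp L n                       -- V!
    ret     : Val L n → Comp L n
    bind    : Comp L n → Comp L (suc n) → Comp L n     -- let x ⇐ M in N
    lam     : Comp L (suc n) → Comp L n
    app     : Comp L n → Val L n → Comp L n
    tup     : Comp L n → Comp L n → Comp L n
    prj     : Fin 2 → Comp L n → Comp L n              -- prj_i (zero = 1, suc zero = 2)
    shift0  : Comp del (suc n) → Comp del n            -- S₀k.M  (k = var 0)
    handle  : Comp del n → Comp del (suc n) → Comp del n  -- ⟨M | x.N⟩
    reflect : Comp mon n → Comp mon n
    reify   : MonadT mon n → Comp mon n → Comp mon n

  data _×_ (A B : Set) : Set where
    _,_ : A → B → A × B

infixr 5 _∷_
infixr 4 _,_

Ren : ℕ → ℕ → Set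
Ren n m = Fin n → Fin m

ext : Ren n m → Ren (suc n) (suc m)
ext ρ zero    = zero
ext ρ (suc i) = suc (ρ i)

mutual
  renV : Ren n m → Val L n → Val L m
  renV ρ (var i)    = var (ρ i)
  renV ρ unit       = unit
  renV ρ (pair V W) = pair (renV ρ V) (renV ρ W)
  renV ρ (inj ℓ V)  = inj ℓ (renV ρ V)
  renV ρ (thunk M)  = thunk (renC ρ M)

  renBr : Ren n m → Branches L n → Branches L m
  renBr ρ []             = []
  renBr ρ ((ℓ , M) ∷ bs) = (ℓ , renC (ext ρ) M) ∷ renBr ρ bs

  renT : Ren n m → MonadT L n → MonadT L m
  renT ρ (monad Nu Nb) = monad (renC (ext ρ) Nu) (renC (ext (ext ρ)) Nb)

  renC : Ren n m → Comp L n → Comp L m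
  renC ρ (letp V M)   = letp (renV ρ V) (renC (ext (ext ρ)) M)
  renC ρ (case V bs)  = case (renV ρ V) (renBr ρ bs)
  renC ρ (force V)    = force (renV ρ V)
  renC ρ (ret V)      = ret (renV ρ V)
  renC ρ (bind M N)   = bind (renC ρ M) (renC (ext ρ) N)
  renC ρ (lam M)      = lam (renC (ext ρ) M)
  renC ρ (app M V)    = app (renC ρ M) (renV ρ V)
  renC ρ (tup M N)    = tup (renC ρ M) (renC ρ N)
  renC ρ (prj i M)    = prj i (renC ρ M)
  renC ρ (shift0 M)   = shift0 (renC (ext ρ) M)
  renC ρ (handle M N) = handle (renC ρ M) (renC (ext ρ) N)
  renC ρ (reflect M)  = reflect (renC ρ M)
  renC ρ (reify T M)  = reify (renT ρ T) (renC ρ M)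

Sub : Lang → ℕ → ℕ → Set
Sub L n m = Fin n → Val L m

exts : Sub L n m → Sub L (suc n) (suc m)
exts σ zero    = var zero
exts σ (suc i) = renV suc (σ i)

mutual
  subV : Sub L n m → Val L n → Val L m
  subV σ (var i)    = σ i
  subV σ unit       = unit
  subV σ (pair V W) = pair (subV σ V) (subV σ W)
  subV σ (inj ℓ V)  = inj ℓ (subV σ V)
  subV σ (thunk M)  = thunk (subC σ M)

  subBr : Sub L n m → Branches L n → Branches L m
  subBr σ []             = []
  subBr σ ((ℓ , M) ∷ bs) = (ℓ , subC (exts σ) M) ∷ subBr σ bs

  subT : Sub L n m → MonadT L n → MonadT L m
  subT σ (monad Nu Nb) = monad (subC (exts σ) Nu) (subC (exts (exts σ)) Nb)

  subC : Sub L n m → Comp L n → Comp L m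
  subC σ (letp V M)   = letp (subV σ V) (subC (exts (exts σ)) M)
  subC σ (case V bs)  = case (subV σ V) (subBr σ bs)
  subC σ (force V)    = force (subV σ V)
  subC σ (ret V)      = ret (subV σ V)
  subC σ (bind M N)   = bind (subC σ M) (subC (exts σ) N)
  subC σ (lam M)      = lam (subC (exts σ) M)
  subC σ (app M V)    = app (subC σ M) (subV σ V)
  subC σ (tup M N)    = tup (subC σ M) (subC σ N)
  subC σ (prj i M)    = prj i (subC σ M)
  subC σ (shift0 M)   = shift0 (subC (exts σ) M)
  subC σ (handle M N) = handle (subC σ M) (subC (exts σ) N)
  subC σ (reflect M)  = reflect (subC σ M)
  subC σ (reify T M)  = reify (subT σ T) (subC σ M)

-- M[V/x]  where x = var 0
_[_]₁ : Comp L (suc n) → Val L n → Comp L n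
M [ V ]₁ = subC σ M
  where
  σ : Sub _ _ _
  σ zero    = V
  σ (suc i) = var i

-- M[V₁/x, V₂/y]  where x = var 1, y = var 0
_[_,_]₂ : Comp L (suc (suc n)) → Val L n → Val L n → Comp L n
M [ V₁ , V₂ ]₂ = subC σ M
  where
  σ : Sub _ _ _
  σ zero          = V₂
  σ (suc zero)    = V₁
  σ (suc (suc i)) = var i

wkC : Comp L n → Comp L (suc n)
wkC = renC suc

data BFrame (L : Lang) (n : ℕ) : Set where
  bindF : Comp L (suc n) → BFrame L n
  appF  : Val L n → BFrame L n
  prjF  : Fin 2 → BFrame L n

plugB : BFrame L n → Comp L n → Comp L n
plugB (bindF N) M = bind M N
plugB (appF V)  M = app M V
plugB (prjF i)  M = prj i M

renB : Ren n m → BFrame L n → BFrame L m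
renB ρ (bindF N) = bindF (renC (ext ρ) N)
renB ρ (appF V)  = appF (renV ρ V)
renB ρ (prjF i)  = prjF i

data Hoist (L : Lang) (n : ℕ) : Set where
  □   : Hoist L n
  _▷_ : Hoist L n → BFrame L n → Hoist L n

plugH : Hoist L n → Comp L n → Comp L n
plugH □       M = M
plugH (H ▷ B) M = plugH H (plugB B M)

renH : Ren n m → Hoist L n → Hoist L m
renH ρ □       = □
renH ρ (H ▷ B) = renH ρ H ▷ renB ρ B

data EFrame : Lang → ℕ → Set where
  basic  : BFrame L n → EFrame L n
  handleF : Comp del (suc n) → EFrame del n
  reifyF : MonadT mon n → EFrame mon n

plugF : EFrame L n → Comp L n → Comp L n
plugF (basic B)   M = plugB B M
plugF (handleF N) M = handle M N
plugF (reifyF T)  M = reify T M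

data ECtx (L : Lang) (n : ℕ) : Set where
  □   : ECtx L n
  _▷_ : ECtx L n → EFrame L n → ECtx L n

plugE : ECtx L n → Comp L n → Comp L n
plugE □       M = M
plugE (K ▷ F) M = plugE K (plugF F M)

lookupBr : Label → Branches L n → Maybe (Comp L (suc n))
lookupBr ℓ []              = nothing
lookupBr ℓ ((ℓ' , M) ∷ bs) = if ℓ ≡ᵇ ℓ' then just M else lookupBr ℓ bs

sel : {A : Set} → Fin 2 → A → A → A
sel zero    a b = a
sel (suc _) a b = b

infix 4 _→β_ _⟶_ _⇝_ _⇝v_ _⇝b_ _⇝T_

data _→β_ : Comp L n → Comp L n → Set where
  β-letp  : ∀ {V₁ V₂ : Val L n} {M} → letp (pair V₁ V₂) M →β M [ V₁ , V₂ ]₂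
  β-case  : ∀ {ℓ} {V : Val L n} {bs M} → lookupBr ℓ bs ≡ just M →
            case (inj ℓ V) bs →β M [ V ]₁
  β-force : ∀ {M : Comp L n} → force (thunk M) →β M
  β-bind  : ∀ {V : Val L n} {N} → bind (ret V) N →β N [ V ]₁
  β-app   : ∀ {M} {V : Val L n} → app (lam M) V →β M [ V ]₁
  β-prj   : ∀ {i} {M₁ M₂ : Comp L n} → prj i (tup M₁ M₂) →β sel i M₁ M₂
  β-handle-ret   : ∀ {V : Val del n} {N} → handle (ret V) N →β N [ V ]₁
  β-handle-shift : ∀ (H : Hoist del n) {M N} →
    handle (plugH H (shift0 M)) N →β
      M [ thunk (lam (handle (plugH (renH suc H) (ret (var zero)))
                             (renC (ext suc) N))) ]₁
  β-reify-ret     : ∀ {Nu Nb} {V : Val mon n} →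
    reify (monad Nu Nb) (ret V) →β Nu [ V ]₁
  β-reify-reflect : ∀ (H : Hoist mon n) {Nu Nb N} →
    reify (monad Nu Nb) (plugH H (reflect N)) →β
      Nb [ thunk N ,
           thunk (lam (reify (renT suc (monad Nu Nb))
                             (plugH (renH suc H) (ret (var zero))))) ]₂

data _⟶_ : Comp L n → Comp L n → Set where
  step : ∀ (K : ECtx L n) {M' N'} → M' →β N' → plugE K M' ⟶ plugE K N'

mutual
  data _⇝_ : Comp L n → Comp L n → Set where
    β        : ∀ {M N : Comp L n} → M →β N → M ⇝ N
    letp-v   : ∀ {V V' : Val L n} {M} → V ⇝v V' → letp V M ⇝ letp V' M
    letp-c   : ∀ {V : Val L n} {M M'} → M ⇝ M' → letp V M ⇝ letp V M'
    case-v   : ∀ {V V' : Val L n} {bs} → V ⇝v V' → case V bs ⇝ case V' bs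
    case-b   : ∀ {V : Val L n} {bs bs'} → bs ⇝b bs' → case V bs ⇝ case V bs'
    force-v  : ∀ {V V' : Val L n} → V ⇝v V' → force V ⇝ force V'
    ret-v    : ∀ {V V' : Val L n} → V ⇝v V' → ret V ⇝ ret V'
    bind-l   : ∀ {M M' : Comp L n} {N} → M ⇝ M' → bind M N ⇝ bind M' N
    bind-r   : ∀ {M : Comp L n} {N N'} → N ⇝ N' → bind M N ⇝ bind M N'
    lam-c    : ∀ {M M' : Comp L (suc n)} → M ⇝ M' → lam M ⇝ lam M'
    app-l    : ∀ {M M' : Comp L n} {V} → M ⇝ M' → app M V ⇝ app M' V
    app-r    : ∀ {M : Comp L n} {V V'} → V ⇝v V' → app M V ⇝ app M V'
    tup-l    : ∀ {M M' N : Comp L n} → M ⇝ M' → tup M N ⇝ tup M' N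
    tup-r    : ∀ {M N N' : Comp L n} → N ⇝ N' → tup M N ⇝ tup M N'
    prj-c    : ∀ {i} {M M' : Comp L n} → M ⇝ M' → prj i M ⇝ prj i M'
    shift0-c : ∀ {M M' : Comp del (suc n)} → M ⇝ M' → shift0 M ⇝ shift0 M'
    handle-l : ∀ {M M' : Comp del n} {N} → M ⇝ M' → handle M N ⇝ handle M' N
    handle-r : ∀ {M : Comp del n} {N N'} → N ⇝ N' → handle M N ⇝ handle M N'
    reflect-c : ∀ {M M' : Comp mon n} → M ⇝ M' → reflect M ⇝ reflect M'
    reify-T  : ∀ {T T' : MonadT mon n} {M} → T ⇝T T' → reify T M ⇝ reify T' M
    reify-c  : ∀ {T : MonadT mon n} {M M'} → M ⇝ M' → reify T M ⇝ reify T M'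

  data _⇝v_ : Val L n → Val L n → Set where
    pair-l  : ∀ {V V' W : Val L n} → V ⇝v V' → pair V W ⇝v pair V' W
    pair-r  : ∀ {V W W' : Val L n} → W ⇝v W' → pair V W ⇝v pair V W'
    inj-v   : ∀ {ℓ} {V V' : Val L n} → V ⇝v V' → inj ℓ V ⇝v inj ℓ V'
    thunk-c : ∀ {M M' : Comp L n} → M ⇝ M' → thunk M ⇝v thunk M'

  data _⇝b_ : Branches L n → Branches L n → Set where
    here  : ∀ {ℓ} {M M' : Comp L (suc n)} {bs} → M ⇝ M' →
            (ℓ , M) ∷ bs ⇝b (ℓ , M') ∷ bs
    there : ∀ {b} {bs bs' : Branches L n} → bs ⇝b bs' → b ∷ bs ⇝b b ∷ bs'

  data _⇝T_ : MonadT L n → MonadT L n → Set where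
    unit-c : ∀ {Nu Nu' : Comp L (suc n)} {Nb} → Nu ⇝ Nu' → monad Nu Nb ⇝T monad Nu' Nb
    bnd-c  : ∀ {Nu : Comp L (suc n)} {Nb Nb'} → Nb ⇝ Nb' → monad Nu Nb ⇝T monad Nu Nb'

_⇝⁺_ : Comp L n → Comp L n → Set
_⇝⁺_ = TransClosure _⇝_

-- The continuation monad
--   Cont = where{return x = λc. c! x ; m >>= f = λc. m! {λy. f! y c}}

Cont : MonadT mon n
Cont = monad
  (lam (app (force (var zero)) (var (suc zero))))
  (lam (app (force (var (suc (suc zero))))
            (thunk (lam (app (app (force (var (suc (suc zero)))) (var zero))
                             (var (suc zero)))))))

mutual
  trV : Val del n → Val mon n
  trV (var i)    = var i
  trV unit       = unit
  trV (pair V W) = pair (trV V) (trV W)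
  trV (inj ℓ V)  = inj ℓ (trV V)
  trV (thunk M)  = thunk (tr M)

  trBr : Branches del n → Branches mon n
  trBr []             = []
  trBr ((ℓ , M) ∷ bs) = (ℓ , tr M) ∷ trBr bs

  tr : Comp del n → Comp mon n
  tr (letp V M)   = letp (trV V) (tr M)
  tr (case V bs)  = case (trV V) (trBr bs)
  tr (force V)    = force (trV V)
  tr (ret V)      = ret (trV V)
  tr (bind M N)   = bind (tr M) (tr N)
  tr (lam M)      = lam (tr M)
  tr (app M V)    = app (tr M) (trV V)
  tr (tup M N)    = tup (tr M) (tr N)
  tr (prj i M)    = prj i (tr M)
  tr (shift0 M)   = reflect (lam (tr M))
  tr (handle M N) = app (reify Cont (tr M)) (thunk (lam (tr N)))

-- The translation commutes with renaming and substitution, so every core β-step of the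
-- source is matched by the same β-step of the target, and evaluation contexts are
-- translated to contexts in which the target may reduce. Only the two handler rules need
-- work. ⟨return V | x.N⟩* reduces by reify-return and three administrative steps of the
-- continuation monad. ⟨H[S₀k.M] | x.N⟩* reduces by reify-reflect, Cont's bind and β-steps to
-- M*[{λy. (λz. reify_Cont H*[return z])! y c}/k]; contracting the inner redexes, which
-- lie under a λ (this is why the target relation is ⇝ rather than →), turns the argument
-- into the translation {λy. ⟨H[return y] | x.N⟩}* of the source continuation.
module Submission where

open import Defs
open import Data.Nat using (ℕ; zero; suc; _≡ᵇ_)
open import Data.Fin using (Fin; zero; suc)
open import Data.Maybe using (just)
import Data.Maybe as Maybe
open import Data.Bool using (true; false)
open import Relation.Binary.PropositionalEquality using (_≡_; refl; sym; trans; cong; cong₂)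
open import Relation.Binary.Construct.Closure.Transitive using (TransClosure; [_]; _∷_)

private
  variable
    k : ℕ

exts-var≡ext : {σ : Sub L n m} {ρ : Ren n m} → (∀ i → σ i ≡ var (ρ i)) →
               ∀ i → exts σ i ≡ var (ext ρ i)
exts-var≡ext h zero    = refl
exts-var≡ext h (suc i) = cong (renV suc) (h i)

mutual
  subV-var≡renV : {σ : Sub L n m} {ρ : Ren n m} → (∀ i → σ i ≡ var (ρ i)) →
                  (V : Val L n) → subV σ V ≡ renV ρ V
  subV-var≡renV h (var i)    = h i
  subV-var≡renV h unit       = refl
  subV-var≡renV h (pair V W) = cong₂ pair (subV-var≡renV h V) (subV-var≡renV h W)
  subV-var≡renV h (inj ℓ V)  = cong (inj ℓ) (subV-var≡renV h V)
  subV-var≡renV h (thunk M)  = cong thunk (subC-var≡renC h M)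

  subBr-var≡renBr : {σ : Sub L n m} {ρ : Ren n m} → (∀ i → σ i ≡ var (ρ i)) →
                    (bs : Branches L n) → subBr σ bs ≡ renBr ρ bs
  subBr-var≡renBr h []             = refl
  subBr-var≡renBr h ((ℓ , M) ∷ bs) =
    cong₂ (λ M' bs' → (ℓ , M') ∷ bs') (subC-var≡renC (exts-var≡ext h) M) (subBr-var≡renBr h bs)

  subT-var≡renT : {σ : Sub L n m} {ρ : Ren n m} → (∀ i → σ i ≡ var (ρ i)) →
                  (T : MonadT L n) → subT σ T ≡ renT ρ T
  subT-var≡renT h (monad Nu Nb) =
    cong₂ monad (subC-var≡renC (exts-var≡ext h) Nu)
                (subC-var≡renC (exts-var≡ext (exts-var≡ext h)) Nb)

  subC-var≡renC : {σ : Sub L n m} {ρ : Ren n m} → (∀ i → σ i ≡ var (ρ i)) →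
                  (M : Comp L n) → subC σ M ≡ renC ρ M
  subC-var≡renC h (letp V M)   =
    cong₂ letp (subV-var≡renV h V) (subC-var≡renC (exts-var≡ext (exts-var≡ext h)) M)
  subC-var≡renC h (case V bs)  = cong₂ case (subV-var≡renV h V) (subBr-var≡renBr h bs)
  subC-var≡renC h (force V)    = cong force (subV-var≡renV h V)
  subC-var≡renC h (ret V)      = cong ret (subV-var≡renV h V)
  subC-var≡renC h (bind M N)   = cong₂ bind (subC-var≡renC h M) (subC-var≡renC (exts-var≡ext h) N)
  subC-var≡renC h (lam M)      = cong lam (subC-var≡renC (exts-var≡ext h) M)
  subC-var≡renC h (app M V)    = cong₂ app (subC-var≡renC h M) (subV-var≡renV h V)
  subC-var≡renC h (tup M N)    = cong₂ tup (subC-var≡renC h M) (subC-var≡renC h N)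
  subC-var≡renC h (prj i M)    = cong (prj i) (subC-var≡renC h M)
  subC-var≡renC h (shift0 M)   = cong shift0 (subC-var≡renC (exts-var≡ext h) M)
  subC-var≡renC h (handle M N) = cong₂ handle (subC-var≡renC h M) (subC-var≡renC (exts-var≡ext h) N)
  subC-var≡renC h (reflect M)  = cong reflect (subC-var≡renC h M)
  subC-var≡renC h (reify T M)  = cong₂ reify (subT-var≡renT h T) (subC-var≡renC h M)

exts-id : {σ : Sub L n n} → (∀ i → σ i ≡ var i) → ∀ i → exts σ i ≡ var i
exts-id h zero    = refl
exts-id h (suc i) = cong (renV suc) (h i)

mutual
  subV-id : {σ : Sub L n n} → (∀ i → σ i ≡ var i) → (V : Val L n) → subV σ V ≡ V
  subV-id h (var i)    = h i
  subV-id h unit       = refl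
  subV-id h (pair V W) = cong₂ pair (subV-id h V) (subV-id h W)
  subV-id h (inj ℓ V)  = cong (inj ℓ) (subV-id h V)
  subV-id h (thunk M)  = cong thunk (subC-id h M)

  subBr-id : {σ : Sub L n n} → (∀ i → σ i ≡ var i) → (bs : Branches L n) → subBr σ bs ≡ bs
  subBr-id h []             = refl
  subBr-id h ((ℓ , M) ∷ bs) = cong₂ (λ M' bs' → (ℓ , M') ∷ bs') (subC-id (exts-id h) M) (subBr-id h bs)

  subT-id : {σ : Sub L n n} → (∀ i → σ i ≡ var i) → (T : MonadT L n) → subT σ T ≡ T
  subT-id h (monad Nu Nb) = cong₂ monad (subC-id (exts-id h) Nu) (subC-id (exts-id (exts-id h)) Nb)

  subC-id : {σ : Sub L n n} → (∀ i → σ i ≡ var i) → (M : Comp L n) → subC σ M ≡ M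
  subC-id h (letp V M)   = cong₂ letp (subV-id h V) (subC-id (exts-id (exts-id h)) M)
  subC-id h (case V bs)  = cong₂ case (subV-id h V) (subBr-id h bs)
  subC-id h (force V)    = cong force (subV-id h V)
  subC-id h (ret V)      = cong ret (subV-id h V)
  subC-id h (bind M N)   = cong₂ bind (subC-id h M) (subC-id (exts-id h) N)
  subC-id h (lam M)      = cong lam (subC-id (exts-id h) M)
  subC-id h (app M V)    = cong₂ app (subC-id h M) (subV-id h V)
  subC-id h (tup M N)    = cong₂ tup (subC-id h M) (subC-id h N)
  subC-id h (prj i M)    = cong (prj i) (subC-id h M)
  subC-id h (shift0 M)   = cong shift0 (subC-id (exts-id h) M)
  subC-id h (handle M N) = cong₂ handle (subC-id h M) (subC-id (exts-id h) N)
  subC-id h (reflect M)  = cong reflect (subC-id h M)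
  subC-id h (reify T M)  = cong₂ reify (subT-id h T) (subC-id h M)

exts∘ext : {σ : Sub L m k} {ρ : Ren n m} {τ : Sub L n k} → (∀ i → τ i ≡ σ (ρ i)) →
           ∀ i → exts τ i ≡ exts σ (ext ρ i)
exts∘ext h zero    = refl
exts∘ext h (suc i) = cong (renV suc) (h i)

mutual
  subV∘renV : {σ : Sub L m k} {ρ : Ren n m} {τ : Sub L n k} → (∀ i → τ i ≡ σ (ρ i)) →
              (V : Val L n) → subV σ (renV ρ V) ≡ subV τ V
  subV∘renV h (var i)    = sym (h i)
  subV∘renV h unit       = refl
  subV∘renV h (pair V W) = cong₂ pair (subV∘renV h V) (subV∘renV h W)
  subV∘renV h (inj ℓ V)  = cong (inj ℓ) (subV∘renV h V)
  subV∘renV h (thunk M)  = cong thunk (subC∘renC h M)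

  subBr∘renBr : {σ : Sub L m k} {ρ : Ren n m} {τ : Sub L n k} → (∀ i → τ i ≡ σ (ρ i)) →
                (bs : Branches L n) → subBr σ (renBr ρ bs) ≡ subBr τ bs
  subBr∘renBr h []             = refl
  subBr∘renBr h ((ℓ , M) ∷ bs) =
    cong₂ (λ M' bs' → (ℓ , M') ∷ bs') (subC∘renC (exts∘ext h) M) (subBr∘renBr h bs)

  subT∘renT : {σ : Sub L m k} {ρ : Ren n m} {τ : Sub L n k} → (∀ i → τ i ≡ σ (ρ i)) →
              (T : MonadT L n) → subT σ (renT ρ T) ≡ subT τ T
  subT∘renT h (monad Nu Nb) =
    cong₂ monad (subC∘renC (exts∘ext h) Nu) (subC∘renC (exts∘ext (exts∘ext h)) Nb)

  subC∘renC : {σ : Sub L m k} {ρ : Ren n m} {τ : Sub L n k} → (∀ i → τ i ≡ σ (ρ i)) →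
              (M : Comp L n) → subC σ (renC ρ M) ≡ subC τ M
  subC∘renC h (letp V M)   = cong₂ letp (subV∘renV h V) (subC∘renC (exts∘ext (exts∘ext h)) M)
  subC∘renC h (case V bs)  = cong₂ case (subV∘renV h V) (subBr∘renBr h bs)
  subC∘renC h (force V)    = cong force (subV∘renV h V)
  subC∘renC h (ret V)      = cong ret (subV∘renV h V)
  subC∘renC h (bind M N)   = cong₂ bind (subC∘renC h M) (subC∘renC (exts∘ext h) N)
  subC∘renC h (lam M)      = cong lam (subC∘renC (exts∘ext h) M)
  subC∘renC h (app M V)    = cong₂ app (subC∘renC h M) (subV∘renV h V)
  subC∘renC h (tup M N)    = cong₂ tup (subC∘renC h M) (subC∘renC h N)
  subC∘renC h (prj i M)    = cong (prj i) (subC∘renC h M)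
  subC∘renC h (shift0 M)   = cong shift0 (subC∘renC (exts∘ext h) M)
  subC∘renC h (handle M N) = cong₂ handle (subC∘renC h M) (subC∘renC (exts∘ext h) N)
  subC∘renC h (reflect M)  = cong reflect (subC∘renC h M)
  subC∘renC h (reify T M)  = cong₂ reify (subT∘renT h T) (subC∘renC h M)

subV-renV-suc-cancel : {σ : Sub L (suc n) n} → (∀ i → σ (suc i) ≡ var i) →
                       (V : Val L n) → subV σ (renV suc V) ≡ V
subV-renV-suc-cancel h V = trans (subV∘renV (λ i → sym (h i)) V) (subV-id (λ _ → refl) V)

subV-renV-suc²-cancel : {σ : Sub L (suc (suc n)) (suc n)} → (∀ i → σ (suc (suc i)) ≡ var (suc i)) →
                        (V : Val L n) → subV σ (renV suc (renV suc V)) ≡ renV suc V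
subV-renV-suc²-cancel h V =
  trans (subV∘renV (λ _ → refl) (renV suc V))
        (trans (subV∘renV (λ _ → refl) V) (subV-var≡renV h V))

subC-renC-ext-suc-cancel : {σ : Sub L (suc (suc n)) (suc n)} →
                           σ zero ≡ var zero → (∀ i → σ (suc (suc i)) ≡ var (suc i)) →
                           (M : Comp L (suc n)) → subC σ (renC (ext suc) M) ≡ M
subC-renC-ext-suc-cancel h₀ h M =
  trans (subC∘renC (λ { zero → sym h₀ ; (suc i) → sym (h i) }) M) (subC-id (λ _ → refl) M)

mutual
  trV-renV : (ρ : Ren n m) (V : Val del n) → trV (renV ρ V) ≡ renV ρ (trV V)
  trV-renV ρ (var i)    = refl
  trV-renV ρ unit       = refl
  trV-renV ρ (pair V W) = cong₂ pair (trV-renV ρ V) (trV-renV ρ W)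
  trV-renV ρ (inj ℓ V)  = cong (inj ℓ) (trV-renV ρ V)
  trV-renV ρ (thunk M)  = cong thunk (tr-renC ρ M)

  trBr-renBr : (ρ : Ren n m) (bs : Branches del n) → trBr (renBr ρ bs) ≡ renBr ρ (trBr bs)
  trBr-renBr ρ []             = refl
  trBr-renBr ρ ((ℓ , M) ∷ bs) = cong₂ (λ M' bs' → (ℓ , M') ∷ bs') (tr-renC (ext ρ) M) (trBr-renBr ρ bs)

  tr-renC : (ρ : Ren n m) (M : Comp del n) → tr (renC ρ M) ≡ renC ρ (tr M)
  tr-renC ρ (letp V M)   = cong₂ letp (trV-renV ρ V) (tr-renC (ext (ext ρ)) M)
  tr-renC ρ (case V bs)  = cong₂ case (trV-renV ρ V) (trBr-renBr ρ bs)
  tr-renC ρ (force V)    = cong force (trV-renV ρ V)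
  tr-renC ρ (ret V)      = cong ret (trV-renV ρ V)
  tr-renC ρ (bind M N)   = cong₂ bind (tr-renC ρ M) (tr-renC (ext ρ) N)
  tr-renC ρ (lam M)      = cong lam (tr-renC (ext ρ) M)
  tr-renC ρ (app M V)    = cong₂ app (tr-renC ρ M) (trV-renV ρ V)
  tr-renC ρ (tup M N)    = cong₂ tup (tr-renC ρ M) (tr-renC ρ N)
  tr-renC ρ (prj i M)    = cong (prj i) (tr-renC ρ M)
  tr-renC ρ (shift0 M)   = cong (λ M' → reflect (lam M')) (tr-renC (ext ρ) M)
  tr-renC ρ (handle M N) =
    cong₂ (λ M' N' → app (reify Cont M') (thunk (lam N'))) (tr-renC ρ M) (tr-renC (ext ρ) N)

exts-tr : {σ : Sub del n m} {τ : Sub mon n m} → (∀ i → τ i ≡ trV (σ i)) →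
          ∀ i → exts τ i ≡ trV (exts σ i)
exts-tr h zero = refl
exts-tr {σ = σ} h (suc i) = trans (cong (renV suc) (h i)) (sym (trV-renV suc (σ i)))

mutual
  trV-subV : {σ : Sub del n m} {τ : Sub mon n m} → (∀ i → τ i ≡ trV (σ i)) →
             (V : Val del n) → trV (subV σ V) ≡ subV τ (trV V)
  trV-subV h (var i)    = sym (h i)
  trV-subV h unit       = refl
  trV-subV h (pair V W) = cong₂ pair (trV-subV h V) (trV-subV h W)
  trV-subV h (inj ℓ V)  = cong (inj ℓ) (trV-subV h V)
  trV-subV h (thunk M)  = cong thunk (tr-subC h M)

  trBr-subBr : {σ : Sub del n m} {τ : Sub mon n m} → (∀ i → τ i ≡ trV (σ i)) →
               (bs : Branches del n) → trBr (subBr σ bs) ≡ subBr τ (trBr bs)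
  trBr-subBr h []             = refl
  trBr-subBr h ((ℓ , M) ∷ bs) = cong₂ (λ M' bs' → (ℓ , M') ∷ bs') (tr-subC (exts-tr h) M) (trBr-subBr h bs)

  tr-subC : {σ : Sub del n m} {τ : Sub mon n m} → (∀ i → τ i ≡ trV (σ i)) →
            (M : Comp del n) → tr (subC σ M) ≡ subC τ (tr M)
  tr-subC h (letp V M)   = cong₂ letp (trV-subV h V) (tr-subC (exts-tr (exts-tr h)) M)
  tr-subC h (case V bs)  = cong₂ case (trV-subV h V) (trBr-subBr h bs)
  tr-subC h (force V)    = cong force (trV-subV h V)
  tr-subC h (ret V)      = cong ret (trV-subV h V)
  tr-subC h (bind M N)   = cong₂ bind (tr-subC h M) (tr-subC (exts-tr h) N)
  tr-subC h (lam M)      = cong lam (tr-subC (exts-tr h) M)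
  tr-subC h (app M V)    = cong₂ app (tr-subC h M) (trV-subV h V)
  tr-subC h (tup M N)    = cong₂ tup (tr-subC h M) (tr-subC h N)
  tr-subC h (prj i M)    = cong (prj i) (tr-subC h M)
  tr-subC h (shift0 M)   = cong (λ M' → reflect (lam M')) (tr-subC (exts-tr h) M)
  tr-subC h (handle M N) =
    cong₂ (λ M' N' → app (reify Cont M') (thunk (lam N'))) (tr-subC h M) (tr-subC (exts-tr h) N)

tr-[]₁ : (M : Comp del (suc n)) (V : Val del n) → tr (M [ V ]₁) ≡ tr M [ trV V ]₁
tr-[]₁ M V = tr-subC (λ { zero → refl ; (suc i) → refl }) M

tr-[,]₂ : (M : Comp del (suc (suc n))) (V W : Val del n) → tr (M [ V , W ]₂) ≡ tr M [ trV V , trV W ]₂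
tr-[,]₂ M V W = tr-subC (λ { zero → refl ; (suc zero) → refl ; (suc (suc i)) → refl }) M

trB : BFrame del n → BFrame mon n
trB (bindF N) = bindF (tr N)
trB (appF V)  = appF (trV V)
trB (prjF i)  = prjF i

trH : Hoist del n → Hoist mon n
trH □       = □
trH (H ▷ B) = trH H ▷ trB B

tr-plugB : (B : BFrame del n) (M : Comp del n) → tr (plugB B M) ≡ plugB (trB B) (tr M)
tr-plugB (bindF N) M = refl
tr-plugB (appF V)  M = refl
tr-plugB (prjF i)  M = refl

tr-plugH : (H : Hoist del n) (M : Comp del n) → tr (plugH H M) ≡ plugH (trH H) (tr M)
tr-plugH □       M = refl
tr-plugH (H ▷ B) M = trans (tr-plugH H (plugB B M)) (cong (plugH (trH H)) (tr-plugB B M))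

trB-renB : (ρ : Ren n m) (B : BFrame del n) → trB (renB ρ B) ≡ renB ρ (trB B)
trB-renB ρ (bindF N) = cong bindF (tr-renC (ext ρ) N)
trB-renB ρ (appF V)  = cong appF (trV-renV ρ V)
trB-renB ρ (prjF i)  = refl

trH-renH : (ρ : Ren n m) (H : Hoist del n) → trH (renH ρ H) ≡ renH ρ (trH H)
trH-renH ρ □       = refl
trH-renH ρ (H ▷ B) = cong₂ _▷_ (trH-renH ρ H) (trB-renB ρ B)

infixr 2 _⇝⟨_⟩_ _≡⟨_⟩_
infix  3 _⇝⟨_⟩∎

_⇝⟨_⟩_ : (M : Comp L n) {N P : Comp L n} → M ⇝ N → N ⇝⁺ P → M ⇝⁺ P
M ⇝⟨ s ⟩ r = s ∷ r

_≡⟨_⟩_ : (M : Comp L n) {N P : Comp L n} → M ≡ N → N ⇝⁺ P → M ⇝⁺ P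
M ≡⟨ refl ⟩ r = r

_⇝⟨_⟩∎ : (M : Comp L n) {N : Comp L n} → M ⇝ N → M ⇝⁺ N
M ⇝⟨ s ⟩∎ = [ s ]

β≡ : {M N N' : Comp L n} → M →β N → N ≡ N' → M ⇝ N'
β≡ s refl = β s

map⁺ : {A B : Set} {R : A → A → Set} {S : B → B → Set} {f : A → B} →
       (∀ {a b} → R a b → S (f a) (f b)) → ∀ {a b} → TransClosure R a b → TransClosure S (f a) (f b)
map⁺ g [ s ]   = [ g s ]
map⁺ g (s ∷ r) = g s ∷ map⁺ g r

lookupBr-trBr : ∀ ℓ (bs : Branches del n) {M} →
                lookupBr ℓ bs ≡ just M → lookupBr ℓ (trBr bs) ≡ just (tr M)
lookupBr-trBr ℓ []               ()
lookupBr-trBr ℓ ((ℓ' , M') ∷ bs) eq with ℓ ≡ᵇ ℓ'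
... | true  = cong (Maybe.map tr) eq
... | false = lookupBr-trBr ℓ bs eq

sel-tr : (i : Fin 2) (M₁ M₂ : Comp del n) → sel i (tr M₁) (tr M₂) ≡ tr (sel i M₁ M₂)
sel-tr zero    M₁ M₂ = refl
sel-tr (suc _) M₁ M₂ = refl

tr-handle-ret : (V : Val del n) (N : Comp del (suc n)) → tr (handle (ret V) N) ⇝⁺ tr (N [ V ]₁)
tr-handle-ret V N =
  app (reify Cont (ret V*)) C
    ⇝⟨ app-l (β β-reify-ret) ⟩
  app (lam (app (force (var zero)) (renV suc V*))) C
    ⇝⟨ β≡ β-app (cong (app (force C)) (subV-renV-suc-cancel (λ _ → refl) V*)) ⟩
  app (force C) V*
    ⇝⟨ app-l (β β-force) ⟩
  app (lam (tr N)) V*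
    ⇝⟨ β≡ β-app (sym (tr-[]₁ N V)) ⟩∎
  where
  V* = trV V
  C  = thunk (lam (tr N))

tr-continuation : (H : Hoist del n) (N : Comp del (suc n)) →
  thunk (lam (app (reify Cont (plugH (renH suc (trH H)) (ret (var zero)))) (thunk (lam (renC (ext suc) (tr N))))))
  ≡ trV (thunk (lam (handle (plugH (renH suc H) (ret (var zero))) (renC (ext suc) N))))
tr-continuation H N =
  cong₂ (λ M' N' → thunk (lam (app (reify Cont M') (thunk (lam N')))))
        (sym (trans (tr-plugH (renH suc H) (ret (var zero)))
                    (cong (λ H' → plugH H' (ret (var zero))) (trH-renH suc H))))
        (sym (tr-renC (ext suc) N))

tr-handle-shift : (H : Hoist del n) (M : Comp del (suc n)) (N : Comp del (suc n)) →
  tr (handle (plugH H (shift0 M)) N) ⇝⁺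
  tr (M [ thunk (lam (handle (plugH (renH suc H) (ret (var zero))) (renC (ext suc) N))) ]₁)
tr-handle-shift H M N =
  tr (handle (plugH H (shift0 M)) N)
    ≡⟨ cong (λ M' → app (reify Cont M') C) (tr-plugH H (shift0 M)) ⟩
  app (reify Cont (plugH (trH H) (reflect (lam (tr M))))) C
    ⇝⟨ app-l (β (β-reify-reflect (trH H))) ⟩
  app (lam (app (force (renV suc A))
                (thunk (lam (app (app (force (renV suc (renV suc K))) (var zero)) (var (suc zero))))))) C
    ⇝⟨ β≡ β-app (cong₂ app (cong force (subV-renV-suc-cancel (λ _ → refl) A))
                    (cong (λ K' → thunk (lam (app (app (force K') (var zero)) (renV suc C))))
                          (subV-renV-suc²-cancel (λ _ → refl) K))) ⟩
  app (force A) (thunk (lam (app (app (force (renV suc K)) (var zero)) (renV suc C))))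
    ⇝⟨ app-r (thunk-c (lam-c (app-l (app-l (β β-force))))) ⟩
  app (force A) (thunk (lam (app (app (lam (renC (ext suc) R)) (var zero)) (renV suc C))))
    ⇝⟨ app-r (thunk-c (lam-c (app-l (β≡ β-app (subC-renC-ext-suc-cancel refl (λ _ → refl) R))))) ⟩
  app (force A) (thunk (lam (app R (renV suc C))))
    ≡⟨ cong (app (force A)) (tr-continuation H N) ⟩
  app (force A) (trV W)
    ⇝⟨ app-l (β β-force) ⟩
  app (lam (tr M)) (trV W)
    ⇝⟨ β≡ β-app (sym (tr-[]₁ M W)) ⟩∎
  where
  A = thunk (lam (tr M))
  C = thunk (lam (tr N))
  R = reify Cont (plugH (renH suc (trH H)) (ret (var zero)))
  K = thunk (lam R)
  W = thunk (lam (handle (plugH (renH suc H) (ret (var zero))) (renC (ext suc) N)))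

tr-→β : {M N : Comp del n} → M →β N → tr M ⇝⁺ tr N
tr-→β (β-letp {V₁ = V₁} {V₂} {M})     = [ β≡ β-letp (sym (tr-[,]₂ M V₁ V₂)) ]
tr-→β (β-case {ℓ = ℓ} {V} {bs} {M} eq) = [ β≡ (β-case (lookupBr-trBr ℓ bs eq)) (sym (tr-[]₁ M V)) ]
tr-→β β-force                         = [ β β-force ]
tr-→β (β-bind {V = V} {N})            = [ β≡ β-bind (sym (tr-[]₁ N V)) ]
tr-→β (β-app {M = M} {V})             = [ β≡ β-app (sym (tr-[]₁ M V)) ]
tr-→β (β-prj {i = i} {M₁} {M₂})       = [ β≡ β-prj (sel-tr i M₁ M₂) ]
tr-→β (β-handle-ret {V = V} {N})      = tr-handle-ret V N
tr-→β (β-handle-shift H {M} {N})      = tr-handle-shift H M N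

tr-plugF-⇝⁺ : (F : EFrame del n) {M N : Comp del n} → tr M ⇝⁺ tr N → tr (plugF F M) ⇝⁺ tr (plugF F N)
tr-plugF-⇝⁺ (basic (bindF N)) = map⁺ bind-l
tr-plugF-⇝⁺ (basic (appF V))  = map⁺ app-l
tr-plugF-⇝⁺ (basic (prjF i))  = map⁺ prj-c
tr-plugF-⇝⁺ (handleF N)       = map⁺ (λ s → app-l (reify-c s))

tr-plugE-⇝⁺ : (K : ECtx del n) {M N : Comp del n} → tr M ⇝⁺ tr N → tr (plugE K M) ⇝⁺ tr (plugE K N)
tr-plugE-⇝⁺ □       r = r
tr-plugE-⇝⁺ (K ▷ F) r = tr-plugE-⇝⁺ K (tr-plugF-⇝⁺ F r)

theorem6p1 : (n : ℕ) (M N : Comp del n) → M ⟶ N → tr M ⇝⁺ tr N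
theorem6p1 n _ _ (step K s) = tr-plugE-⇝⁺ K (tr-→β s)
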